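{- Let $p>0$, let $Q=(q_1,\dots,q_J,e_0)\in M_p^+$ with $D(Q)\neq\emptyset$, and let $Q^\infty=C_p^\infty(Q)=(q_1,q_2,\dots)$ with $r$-indexes $r_0=0<r_1<r_2<\cdots$. If $r$ is an even vector period of $Q^\infty$, then there exists $j>0$ such that $r=r_j$.
   Context: $M$ is the set of integer vectors $(v_1,\dots,v_{J+1})$ with $J\ge1$ odd, $v_i\ge1$ for $1\le i\le J$, $v_{J+1}\ge0$. Alternating parameters of $V\in M$: $\rho_0=0$, $\rho_{i+1}=\rho_i+v_{i+1}$ for $i$ even, $\rho_{i+1}=\rho_i-v_{i+1}$ for $i$ odd. $M_p^+$ is the set of $V\in M$ for which there is an odd $t$, $1\le t\le J$, with $\rho_i>0$ for $1\le i\le t$ and $\rho_t\ge p+1$ (for $p>0$ such $V$ have $v_1>1$). Distance vector of a finite $V=(v_1,\dots,v_{J+1})\in M$ with $v_1>1$: $\tau_V(0)=0$, $\tau_V(r)=(v_1-1)+\cdots+(v_r-1)$; $D(V)=\emptyset$ if $v_i>1$ for all $1\le i\le J$; otherwise $c_0=0$ and, while it exists, $c_{i+1}$ is the least $c$ with $c_i+1<c\le J$ and $v_c=1$; with $c_\gamma$ the last, $D(V)=(\tau_V(c_1),\dots,\tau_V(c_\gamma))$. Shift symmetric vector: $\lambda_0=p+1$; for $j\ge0$: if $j$ even, $s_{j+1}=\min\{q_{j+1},\lambda_j\}$, $\lambda_{j+1}=\lambda_j-s_{j+1}$; if $j$ odd, $s_{j+1}=\min\{q_{j+1},p+1-\lambda_j\}$,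 $\lambda_{j+1}=\lambda_j+s_{j+1}$; $e_{j+1}=q_{j+1}-s_{j+1}$ and $q_{J+j+1}=e_j+s_{j+1}$. $C_p^\infty(Q)=(q_1,q_2,\dots)$. An even vector period of $Q^\infty$ is an even $r>0$ with $q_{r+i}=q_i$ for all $i\ge1$. $r$-indexes of $Q^\infty$: for $r\ge0$, $next(r)=r+2t+1$ where $t\ge0$ is maximal with $q_{r+2i}=1$ for $1\le i\le t$ (this is finite under the hypotheses); $r_0=0$ and $r_{j+1}=next(r_j)$ for $j\ge0$. -}

module Defs where

open import Data.Bool using (Bool; true; false; if_then_else_; not)
open import Data.Nat using (ℕ; zero; suc; _+_; _∸_; _≤_; _<_; _⊓_; _≤ᵇ_; _≡ᵇ_)
open import Data.Integer as ℤ using (ℤ; +_; +0)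
open import Data.List using (List; []; _∷_; _++_; [_]; take; length)
open import Data.Product using (_×_; _,_; Σ; ∃-syntax)
open import Relation.Binary.PropositionalEquality using (_≡_; _≢_)

even : ℕ → Bool
even zero = true
even (suc n) = not (even n)

Odd : ℕ → Set
Odd n = even n ≡ false

Even : ℕ → Set
Even n = even n ≡ true

-- 1-indexed entry v_i of a vector given as a list (v_1, ..., v_{J+1});
-- out-of-range indices (including 0) give the junk value 0.
at : List ℕ → ℕ → ℕ
at []       _             = 0
at (x ∷ xs) zero          = 0
at (x ∷ xs) (suc zero)    = x
at (x ∷ xs) (suc (suc i)) = at xs (suc i)

record InM (J : ℕ) (V : List ℕ) : Set where
  field
    len   : length V ≡ suc J
    J-odd : Odd J
    pos   : ∀ i → 1 ≤ i → i ≤ J → 1 ≤ at V i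

ρ : List ℕ → ℕ → ℤ
ρ V zero    = +0
ρ V (suc i) = if even i then ρ V i ℤ.+ (+ at V (suc i))
                        else ρ V i ℤ.- (+ at V (suc i))

InMp+ : ℕ → ℕ → List ℕ → Set
InMp+ p J V = InM J V ×
  (∃[ t ] (Odd t × 1 ≤ t × t ≤ J ×
           (∀ i → 1 ≤ i → i ≤ t → +0 ℤ.< ρ V i) ×
           (+ (suc p) ℤ.≤ ρ V t)))

τ : List ℕ → ℕ → ℕ
τ V zero    = 0
τ V (suc r) = τ V r + (at V (suc r) ∸ 1)

-- scan J V c fuel: lists the positions c_1 < c_2 < ... : starting from the
-- candidate position c, the least c' ≥ c with c' ≤ J and v_{c'} = 1, then
-- continue from c' + 2 (the next c must satisfy c_i + 1 < c).
scan : ℕ → List ℕ → ℕ → ℕ → List ℕ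
scan J V c zero    = []
scan J V c (suc f) =
  if c ≤ᵇ J
  then (if at V c ≡ᵇ 1 then c ∷ scan J V (suc (suc c)) f
                       else scan J V (suc c) f)
  else []

-- (c_1, ..., c_γ); c_0 = 0 so the first candidate is 2.  Fuel J suffices.
cs : ℕ → List ℕ → List ℕ
cs J V = scan J V 2 J

mapτ : List ℕ → List ℕ → List ℕ
mapτ V []       = []
mapτ V (c ∷ l)  = τ V c ∷ mapτ V l

D : ℕ → List ℕ → List ℕ
D J V = mapτ V (cs J V)

-- Shift symmetric vector.  State at stage j: (λ_j , e_j , queue), where the
-- queue holds (q_{j+1}, ..., q_{J+j}).
State : Set
State = ℕ × ℕ × List ℕ

step : ℕ → ℕ → State → State
step p j (l , e , [])       = (l , e , [])   -- never happens (J ≥ 1)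
step p j (l , e , q ∷ rest) =
  let s = if even j then q ⊓ l else q ⊓ (suc p ∸ l)
      l' = if even j then l ∸ s else l + s
  in (l' , q ∸ s , rest ++ [ e + s ])

state : ℕ → ℕ → List ℕ → ℕ → State
state p J V zero    = (suc p , at V (suc J) , take J V)
state p J V (suc j) = step p j (state p J V j)

headOr0 : List ℕ → ℕ
headOr0 []      = 0
headOr0 (x ∷ _) = x

-- C_p^∞(Q) = (q_1, q_2, ...), 1-indexed; index 0 is the junk value 0.
C∞ : ℕ → ℕ → List ℕ → ℕ → ℕ
C∞ p J V zero    = 0
C∞ p J V (suc n) with state p J V n
... | (_ , _ , qs) = headOr0 qs

EvenVectorPeriod : (ℕ → ℕ) → ℕ → Set
EvenVectorPeriod q r = Even r × 0 < r × (∀ i → 1 ≤ i → q (r + i) ≡ q i)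

-- next(r) = r' : r' = r + 2t + 1 with t maximal such that q_{r+2i} = 1 for
-- 1 ≤ i ≤ t (the property is downward closed in t, so maximality means it
-- fails at t + 1).
IsNext : (ℕ → ℕ) → ℕ → ℕ → Set
IsNext q r r' = ∃[ t ] (r' ≡ r + (t + t) + 1 ×
                        (∀ i → 1 ≤ i → i ≤ t → q (r + (i + i)) ≡ 1) ×
                        q (r + (suc t + suc t)) ≢ 1)

data RIndex (q : ℕ → ℕ) : ℕ → ℕ → Set where
  r0    : RIndex q 0 0
  rnext : ∀ {j r r'} → RIndex q j r → IsNext q r r' → RIndex q (suc j) r'

-- Periodicity with even period r makes the queue, the excesses e and the shifts s r-periodic
-- (the queue at stage r is (q_{r+1}, …, q_{r+J}) = (q_1, …, q_J), and the sum of the queue and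
-- e is invariant), so λ drops by the same amount P − λ_r over every period; as 0 ≤ λ ≤ P = p + 1,
-- this forces λ_r = P.  Running the recursion backwards from λ_r = P, a run
-- q_{a+2} = q_{a+4} = … = q_r = 1 with a even forces q_{a+1} = 1, which no r-index a allows
-- (q_1 = v_1 ≥ 2, and next(b) stops just before an entry ≠ 1).  Together with q_{r+1} = q_1 ≠ 1
-- this means the walk r_0 < r_1 < … can neither stop short of r nor jump over it.

module Submission where

open import Defs
open import Data.Bool using (true; false; not; if_then_else_)
open import Data.Bool.Properties using (not-involutive)
open import Data.Nat
open import Data.Nat.Properties
open import Data.Nat.Induction using (<-rec)
open import Data.Nat.ListAction using (sum)
open import Data.Nat.ListAction.Properties using (sum-++)
open import Data.Nat.Tactic.RingSolver using (solve-∀)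
open import Algebra.Properties.CommutativeSemigroup +-commutativeSemigroup using (xy∙z≈xz∙y)
import Data.Integer as ℤ
import Data.Integer.Properties as ℤ
open import Data.List using (List; []; _∷_; _++_; [_]; take; length)
open import Data.List.Properties using (length-take; length-++)
open import Data.Product using (_×_; _,_; proj₁; proj₂; ∃-syntax)
open import Data.Sum using (_⊎_; inj₁; inj₂)
open import Function using (_∘_)
open import Relation.Nullary using (¬_; yes; no; contradiction)
open import Relation.Binary.PropositionalEquality hiding ([_])

even-suc-suc : ∀ n → even (suc (suc n)) ≡ even n
even-suc-suc n = not-involutive (even n)

even-+ˡ : ∀ m n → Even m → even (m + n) ≡ even n
even-+ˡ zero          n _ = refl
even-+ˡ (suc (suc m)) n e =
  trans (even-suc-suc (m + n)) (even-+ˡ m n (trans (sym (even-suc-suc m)) e))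

even-double : ∀ k → Even (k + k)
even-double zero    = refl
even-double (suc k) rewrite +-suc k k = trans (even-suc-suc (k + k)) (even-double k)

even-+-double : ∀ m k → even (m + (k + k)) ≡ even m
even-+-double m k = trans (cong even (+-comm m (k + k))) (even-+ˡ (k + k) m (even-double k))

even-or-odd : ∀ n → Even n ⊎ Odd n
even-or-odd zero    = inj₁ refl
even-or-odd (suc n) with even-or-odd n
... | inj₁ ev  = inj₂ (cong not ev)
... | inj₂ odd = inj₁ (cong not odd)

odd⇒0< : ∀ {n} → Odd n → 0 < n
odd⇒0< {suc _} _ = z<s

halve : ∀ d → ∃[ K ] (K + K ≡ d ⊎ K + K ≡ suc d)
halve zero = 0 , inj₁ refl
halve (suc d) with halve d
... | K , inj₁ K+K≡d   = suc K , inj₂ (cong suc (trans (+-suc K K) (cong suc K+K≡d)))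
... | K , inj₂ K+K≡1+d = K , inj₁ K+K≡1+d

halve-gap : ∀ {a r} → a ≤ r → ∃[ K ] (a + (K + K) ≡ r ⊎ a + (K + K) ≡ suc r)
halve-gap {a} {r} a≤r with halve (r ∸ a) | m+[n∸m]≡n a≤r
... | K , inj₁ 2K≡d   | a+[r∸a]≡r = K , inj₁ (trans (cong (a +_) 2K≡d) a+[r∸a]≡r)
... | K , inj₂ 2K≡1+d | a+[r∸a]≡r =
  K , inj₂ (trans (cong (a +_) 2K≡1+d) (trans (+-suc a (r ∸ a)) (cong suc a+[r∸a]≡r)))

at-one : ∀ xs → at xs 1 ≡ headOr0 xs
at-one []      = refl
at-one (x ∷ xs) = refl

at-take : ∀ n xs k → k < n → at (take n xs) (suc k) ≡ at xs (suc k)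
at-take (suc n) []       k       _         = refl
at-take (suc n) (x ∷ xs) zero    _         = refl
at-take (suc n) (x ∷ xs) (suc k) (s≤s k<n) = at-take n xs k k<n

at-++ˡ : ∀ xs ys k → k < length xs → at (xs ++ ys) (suc k) ≡ at xs (suc k)
at-++ˡ (x ∷ xs) ys zero    _         = refl
at-++ˡ (x ∷ xs) ys (suc k) (s≤s k<n) = at-++ˡ xs ys k k<n

at-++-last : ∀ xs y → at (xs ++ [ y ]) (suc (length xs)) ≡ y
at-++-last []       y = refl
at-++-last (x ∷ xs) y = at-++-last xs y

at-ext : ∀ xs ys → length xs ≡ length ys →
         (∀ k → k < length xs → at xs (suc k) ≡ at ys (suc k)) → xs ≡ ys
at-ext []       []       _   _  = refl
at-ext (x ∷ xs) (y ∷ ys) len eq =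
  cong₂ _∷_ (eq 0 z<s) (at-ext xs ys (suc-injective len) (λ k k<n → eq (suc k) (s≤s k<n)))

-- The r-index walk

OnesAt : (ℕ → ℕ) → ℕ → ℕ → Set
OnesAt q a k = ∀ i → 1 ≤ i → i ≤ k → q (a + (i + i)) ≡ 1

ones-or-next : (q : ℕ → ℕ) → ∀ a K →
               OnesAt q a K ⊎ ∃[ t ] (t < K × IsNext q a (a + (t + t) + 1))
ones-or-next q a zero = inj₁ (λ i 1≤i i≤0 → contradiction (≤-trans 1≤i i≤0) λ ())
ones-or-next q a (suc K) with ones-or-next q a K
... | inj₂ (t , t<K , next) = inj₂ (t , m≤n⇒m≤1+n t<K , next)
... | inj₁ ones with q (a + (suc K + suc K)) ≟ 1
...   | no  q≢1 = inj₂ (K , ≤-refl , K , refl , ones , q≢1)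
...   | yes q≡1 = inj₁ ones′
  where
  ones′ : OnesAt q a (suc K)
  ones′ i 1≤i i≤1+K with m≤n⇒m<n∨m≡n i≤1+K
  ... | inj₁ i<1+K = ones i 1≤i (≤-pred i<1+K)
  ... | inj₂ refl  = q≡1

next-odd-step : ∀ a t → suc (a + (t + t) + 1) ≡ a + (suc t + suc t)
next-odd-step = solve-∀

+-double-suc : ∀ a k → suc (suc (a + (k + k))) ≡ a + (suc k + suc k)
+-double-suc = solve-∀

rindex-succ≢1 : (q : ℕ → ℕ) → q 1 ≢ 1 → ∀ {j a} → RIndex q j a → q (suc a) ≢ 1
rindex-succ≢1 q q₁≢1 r0 = q₁≢1
rindex-succ≢1 q q₁≢1 (rnext {r = b} _ (t , refl , _ , q≢1)) =
  q≢1 ∘ trans (cong q (sym (next-odd-step b t)))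

module RIndexWalk (q : ℕ → ℕ) (r : ℕ) (q₁≢1 : q 1 ≢ 1) (q[1+r]≢1 : q (suc r) ≢ 1)
  (ones-up-to-r : ∀ a k → a + (suc k + suc k) ≡ r → OnesAt q a (suc k) → q (suc a) ≡ 1)
  where

  no-ones-up-to : ∀ {j a} K → RIndex q j a → a < r →
                  a + (K + K) ≡ r ⊎ a + (K + K) ≡ suc r → ¬ OnesAt q a K
  no-ones-up-to {a = a} zero _ a<r a+0≡r⊎1+r _ = <⇒≱ a<r (r≤a a+0≡r⊎1+r)
    where
    r≤a : a + 0 ≡ r ⊎ a + 0 ≡ suc r → r ≤ a
    r≤a (inj₁ a+0≡r)   = ≤-reflexive (trans (sym a+0≡r) (+-identityʳ a))
    r≤a (inj₂ a+0≡1+r) =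
      ≤-trans (n≤1+n r) (≤-reflexive (trans (sym a+0≡1+r) (+-identityʳ a)))
  no-ones-up-to {a = a} (suc k) R _ (inj₁ a+2K≡r) ones =
    rindex-succ≢1 q q₁≢1 R (ones-up-to-r a k a+2K≡r ones)
  no-ones-up-to (suc k) _ _ (inj₂ a+2K≡1+r) ones =
    q[1+r]≢1 (trans (cong q (sym a+2K≡1+r)) (ones (suc k) (s≤s z≤n) ≤-refl))

  next-≤ : ∀ {j a} → RIndex q j a → a < r →
           ∃[ t ] (a + (t + t) + 1 ≤ r × IsNext q a (a + (t + t) + 1))
  next-≤ {a = a} R a<r with halve-gap (<⇒≤ a<r)
  ... | K , a+2K≡r⊎1+r = search (ones-or-next q a K)
    where
    ≤1+r : ∀ {n} → n ≡ r ⊎ n ≡ suc r → n ≤ suc r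
    ≤1+r (inj₁ refl) = n≤1+n r
    ≤1+r (inj₂ refl) = ≤-refl

    search : OnesAt q a K ⊎ ∃[ t ] (t < K × IsNext q a (a + (t + t) + 1)) →
             ∃[ t ] (a + (t + t) + 1 ≤ r × IsNext q a (a + (t + t) + 1))
    search (inj₂ (t , t<K , next)) = t , ≤-pred a+2t+2≤1+r , next
      where
      a+2t+2≤1+r : suc (a + (t + t) + 1) ≤ suc r
      a+2t+2≤1+r = begin
        suc (a + (t + t) + 1) ≡⟨ next-odd-step a t ⟩
        a + (suc t + suc t)   ≤⟨ +-monoʳ-≤ a (+-mono-≤ t<K t<K) ⟩
        a + (K + K)           ≤⟨ ≤1+r a+2K≡r⊎1+r ⟩
        suc r                 ∎
        where open ≤-Reasoning
    search (inj₁ ones) = contradiction ones (no-ones-up-to K R a<r a+2K≡r⊎1+r)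

  reaches : ∀ {j a} → RIndex q j a → a < r → ∃[ j′ ] (0 < j′ × RIndex q j′ r)
  reaches {a = a} R a<r = <-rec Reach reach (r ∸ a) R a<r refl
    where
    Reach : ℕ → Set
    Reach n = ∀ {j a} → RIndex q j a → a < r → r ∸ a ≡ n → ∃[ j′ ] (0 < j′ × RIndex q j′ r)
    reach : ∀ n → (∀ {m} → m < n → Reach m) → Reach n
    reach _ rec {j} {a} R a<r refl with next-≤ R a<r
    ... | t , a′≤r , next with m≤n⇒m<n∨m≡n a′≤r
    ...   | inj₂ refl = suc j , z<s , rnext R next
    ...   | inj₁ a′<r = rec (∸-monoʳ-< a<a′ a′≤r) (rnext R next) a′<r refl
      where
      a<a′ : a < a + (t + t) + 1
      a<a′ = ≤-<-trans (m≤m+n a (t + t)) (m<m+n (a + (t + t)) z<s)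

-- The shift dynamics

-- s_{j+1}, computed from the stage-j state.
stepShift : ℕ → ℕ → State → ℕ
stepShift p j (l , _ , qs) = if even j then headOr0 qs ⊓ l else headOr0 qs ⊓ (suc p ∸ l)

module _ (p j l e : ℕ) where

  step-level-even : ∀ qs → Even j →
                    proj₁ (step p j (l , e , qs)) + stepShift p j (l , e , qs) ≡ l
  step-level-even []       ev rewrite ev = +-identityʳ l
  step-level-even (x ∷ xs) ev rewrite ev = m∸n+n≡m (m⊓n≤n x l)

  step-level-odd : ∀ qs → Odd j →
                   proj₁ (step p j (l , e , qs)) ≡ l + stepShift p j (l , e , qs)
  step-level-odd []       odd rewrite odd = sym (+-identityʳ l)
  step-level-odd (x ∷ xs) odd rewrite odd = refl

  step-excess : ∀ qs → 0 < length qs →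
                proj₁ (proj₂ (step p j (l , e , qs))) ≡ headOr0 qs ∸ stepShift p j (l , e , qs)
  step-excess (x ∷ xs) _ = refl

  step-length : ∀ qs → length (proj₂ (proj₂ (step p j (l , e , qs)))) ≡ length qs
  step-length []       = refl
  step-length (x ∷ xs) = trans (length-++ xs) (+-comm (length xs) 1)

  step-at : ∀ qs k → suc k < length qs →
            at qs (suc (suc k)) ≡ at (proj₂ (proj₂ (step p j (l , e , qs)))) (suc k)
  step-at (x ∷ xs) k (s≤s k<n) = sym (at-++ˡ xs _ k k<n)

  step-at-last : ∀ qs → 0 < length qs →
                 at (proj₂ (proj₂ (step p j (l , e , qs)))) (length qs)
                   ≡ e + stepShift p j (l , e , qs)
  step-at-last (x ∷ xs) _ = at-++-last xs _

  step-sum : ∀ qs → sum (proj₂ (proj₂ (step p j (l , e , qs))))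
                     + proj₁ (proj₂ (step p j (l , e , qs)))
                   ≡ sum qs + e
  step-sum []       = refl
  step-sum (x ∷ xs) = begin
    sum (xs ++ [ e + s ]) + (x ∸ s) ≡⟨ cong (_+ (x ∸ s)) (sum-++ xs [ e + s ]) ⟩
    sum xs + (e + s + 0) + (x ∸ s)  ≡⟨ regroup (sum xs) e s (x ∸ s) ⟩
    s + (x ∸ s) + sum xs + e        ≡⟨ cong (λ y → y + sum xs + e) (m+[n∸m]≡n s≤x) ⟩
    x + sum xs + e                  ∎
    where
    open ≡-Reasoning
    s = stepShift p j (l , e , x ∷ xs)
    s≤x : s ≤ x
    s≤x with even j
    ... | true  = m⊓n≤m x l
    ... | false = m⊓n≤m x (suc p ∸ l)
    regroup : ∀ a b c d → a + (b + c + 0) + d ≡ c + d + a + b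
    regroup = solve-∀

multiples-bounded⇒≡0 : ∀ {P d} → (∀ k → k * d ≤ P) → d ≡ 0
multiples-bounded⇒≡0 {P} {zero}  _     = refl
multiples-bounded⇒≡0 {P} {suc d} bound =
  contradiction (≤-trans (m≤m*n (suc P) (suc d)) (bound (suc P))) (<-irrefl refl)

⊓≡1⇒≡1 : ∀ {x L} → 2 ≤ L → 1 ≤ x → x ⊓ L ≡ 1 → x ≡ 1
⊓≡1⇒≡1 {suc zero}    _   _ _   = refl
⊓≡1⇒≡1 {suc (suc x)} 2≤L _ x⊓L≡1 =
  contradiction (subst (2 ≤_) x⊓L≡1 (⊓-glb (s≤s (s≤s z≤n)) 2≤L)) λ { (s≤s ()) }

backward-arith : ∀ {P L L₁ x} → 2 ≤ P → L ≤ P → 1 ≤ x →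
                 L₁ + x ⊓ L ≡ L → L₁ + 1 ⊓ (P ∸ L₁) ≡ P → L ≡ P × x ≡ 1
backward-arith {P} {zero} {L₁} {x} (s≤s (s≤s _)) _ _ down up
  rewrite ⊓-zeroʳ x | m+n≡0⇒m≡0 L₁ down = contradiction up λ ()
backward-arith {P} {L@(suc _)} {L₁} {x} 2≤P L≤P 1≤x down up =
  L≡P , ⊓≡1⇒≡1 (subst (2 ≤_) (sym L≡P) 2≤P) 1≤x x⊓L≡1
  where
  1≤x⊓L : 1 ≤ x ⊓ L
  1≤x⊓L = ⊓-glb 1≤x (s≤s z≤n)
  L₁<P : L₁ < P
  L₁<P = <-≤-trans (subst (L₁ <_) down (m<m+n L₁ 1≤x⊓L)) L≤P
  L₁+1≡P : L₁ + 1 ≡ P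
  L₁+1≡P = trans (cong (L₁ +_) (sym (m≤n⇒m⊓n≡m (m<n⇒0<n∸m L₁<P)))) up
  L≡P : L ≡ P
  L≡P = ≤-antisym L≤P (begin
    P           ≡⟨ L₁+1≡P ⟨
    L₁ + 1      ≤⟨ +-monoʳ-≤ L₁ 1≤x⊓L ⟩
    L₁ + x ⊓ L  ≡⟨ down ⟩
    L           ∎)
    where open ≤-Reasoning
  x⊓L≡1 : x ⊓ L ≡ 1
  x⊓L≡1 = +-cancelˡ-≡ L₁ _ _ (trans down (trans L≡P (sym L₁+1≡P)))

-- level n = λ_n, excess n = e_n, queue n = (q_{n+1}, …, q_{n+J}) and shift n = s_{n+1}.
module Dynamics (p J : ℕ) (Q : List ℕ) (Q∈M : InM J Q) where

  P : ℕ
  P = suc p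

  q : ℕ → ℕ
  q = C∞ p J Q

  level excess : ℕ → ℕ
  level  n = proj₁ (state p J Q n)
  excess n = proj₁ (proj₂ (state p J Q n))

  queue : ℕ → List ℕ
  queue n = proj₂ (proj₂ (state p J Q n))

  shift : ℕ → ℕ
  shift n = stepShift p n (state p J Q n)

  0<J : 0 < J
  0<J = odd⇒0< (InM.J-odd Q∈M)

  queue-length : ∀ n → length (queue n) ≡ J
  queue-length zero    =
    trans (length-take J Q) (trans (cong (J ⊓_) (InM.len Q∈M)) (m≤n⇒m⊓n≡m (n≤1+n J)))
  queue-length (suc n) =
    trans (step-length p n (level n) (excess n) (queue n)) (queue-length n)

  queue-nonempty : ∀ n → 0 < length (queue n)
  queue-nonempty n = subst (0 <_) (sym (queue-length n)) 0<J

  shift-even : ∀ n → Even n → shift n ≡ q (suc n) ⊓ level n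
  shift-even n ev rewrite ev = refl

  shift-odd : ∀ n → Odd n → shift n ≡ q (suc n) ⊓ (P ∸ level n)
  shift-odd n ev rewrite ev = refl

  level-even : ∀ n → Even n → level (suc n) + shift n ≡ level n
  level-even n = step-level-even p n (level n) (excess n) (queue n)

  level-odd : ∀ n → Odd n → level (suc n) ≡ level n + shift n
  level-odd n = step-level-odd p n (level n) (excess n) (queue n)

  excess-suc : ∀ n → excess (suc n) ≡ q (suc n) ∸ shift n
  excess-suc n = step-excess p n (level n) (excess n) (queue n) (queue-nonempty n)

  queue-at : ∀ n {i} → 1 ≤ i → i ≤ J → at (queue n) i ≡ q (n + i)
  queue-at n {suc zero}    _ _   = trans (at-one (queue n)) (cong q (+-comm 1 n))
  queue-at n {suc (suc i)} _ i≤J = begin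
    at (queue n) (suc (suc i))  ≡⟨ step-at p n (level n) (excess n) (queue n) i
                                     (subst (suc (suc i) ≤_) (sym (queue-length n)) i≤J) ⟩
    at (queue (suc n)) (suc i)  ≡⟨ queue-at (suc n) (s≤s z≤n) (<⇒≤ i≤J) ⟩
    q (suc n + suc i)           ≡⟨ cong q (+-suc n (suc i)) ⟨
    q (n + suc (suc i))         ∎
    where open ≡-Reasoning

  q-initial : ∀ k → k < J → q (suc k) ≡ at Q (suc k)
  q-initial k k<J = trans (sym (queue-at 0 (s≤s z≤n) k<J)) (at-take J Q k k<J)

  q-appended : ∀ n → q (suc (n + J)) ≡ excess n + shift n
  q-appended n = begin
    q (suc n + J)                         ≡⟨ queue-at (suc n) 0<J ≤-refl ⟨
    at (queue (suc n)) J                  ≡⟨ cong (at (queue (suc n))) (queue-length n) ⟨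
    at (queue (suc n)) (length (queue n)) ≡⟨ step-at-last p n (level n) (excess n) (queue n)
                                                          (queue-nonempty n) ⟩
    excess n + shift n                    ∎
    where open ≡-Reasoning

  sum-queue+excess : ∀ n → sum (queue n) + excess n ≡ sum (queue 0) + excess 0
  sum-queue+excess zero    = refl
  sum-queue+excess (suc n) =
    trans (step-sum p n (level n) (excess n) (queue n)) (sum-queue+excess n)

  level-≤ : ∀ n → level n ≤ P
  level-≤ zero = ≤-refl
  level-≤ (suc n) with even-or-odd n
  ... | inj₁ ev  = ≤-trans (subst (level (suc n) ≤_) (level-even n ev) (m≤m+n _ _)) (level-≤ n)
  ... | inj₂ odd = begin
    level (suc n)                       ≡⟨ level-odd n odd ⟩
    level n + shift n                   ≡⟨ cong (level n +_) (shift-odd n odd) ⟩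
    level n + q (suc n) ⊓ (P ∸ level n) ≤⟨ +-monoʳ-≤ (level n) (m⊓n≤n _ _) ⟩
    level n + (P ∸ level n)             ≡⟨ m+[n∸m]≡n (level-≤ n) ⟩
    P                                   ∎
    where open ≤-Reasoning

  level-after-odd-pos : ∀ m → Odd m → 1 ≤ q (suc m) → 1 ≤ level (suc m)
  level-after-odd-pos m odd 1≤q rewrite level-odd m odd | shift-odd m odd with level m
  ... | zero  = ⊓-glb 1≤q (s≤s z≤n)
  ... | suc _ = s≤s z≤n

  level-after-even-< : ∀ m → Even m → 1 ≤ q (suc m) → level (suc m) < P
  level-after-even-< m ev 1≤q = drop (level m) (level-≤ m) (level-even m ev) (shift-even m ev)
    where
    drop : ∀ L → L ≤ P → level (suc m) + shift m ≡ L → shift m ≡ q (suc m) ⊓ L →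
           level (suc m) < P
    drop zero    _   down _   = subst (_< P) (sym (m+n≡0⇒m≡0 (level (suc m)) down)) z<s
    drop (suc L) L≤P down s≡ = <-≤-trans (subst (level (suc m) <_) down (m<m+n _ 1≤s)) L≤P
      where
      1≤s : 1 ≤ shift m
      1≤s = subst (1 ≤_) (sym s≡) (⊓-glb 1≤q (s≤s z≤n))

  shift-pos-zero : 1 ≤ q 1 → 1 ≤ shift 0
  shift-pos-zero 1≤q = ⊓-glb 1≤q (s≤s z≤n)

  shift-pos-suc : ∀ m → 1 ≤ q (suc m) → 1 ≤ q (suc (suc m)) → 1 ≤ shift (suc m)
  shift-pos-suc m 1≤q 1≤q′ with even-or-odd m
  ... | inj₁ ev = subst (1 ≤_) (sym (shift-odd (suc m) (cong not ev)))
                  (⊓-glb 1≤q′ (m<n⇒0<n∸m (level-after-even-< m ev 1≤q)))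
  ... | inj₂ odd = subst (1 ≤_) (sym (shift-even (suc m) (cong not odd)))
                   (⊓-glb 1≤q′ (level-after-odd-pos m odd 1≤q))

  q-pos : ∀ n → 1 ≤ q (suc n)
  q-pos = <-rec (λ n → 1 ≤ q (suc n)) pos
    where
    pos : ∀ n → (∀ {m} → m < n → 1 ≤ q (suc m)) → 1 ≤ q (suc n)
    pos n ih with n <? J
    ... | yes n<J = subst (1 ≤_) (sym (q-initial n n<J)) (InM.pos Q∈M (suc n) (s≤s z≤n) n<J)
    ... | no  n≮J = begin
      1                  ≤⟨ shift-pos (n ∸ J) (∸-monoʳ-< 0<J J≤n) ⟩
      shift m            ≤⟨ m≤n+m _ _ ⟩
      excess m + shift m ≡⟨ q-appended m ⟨
      q (suc (m + J))    ≡⟨ cong (q ∘ suc) (m∸n+n≡m J≤n) ⟩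
      q (suc n)          ∎
      where
      open ≤-Reasoning
      m = n ∸ J
      J≤n = ≮⇒≥ n≮J
      shift-pos : ∀ m → m < n → 1 ≤ shift m
      shift-pos zero    0<n = shift-pos-zero (ih 0<n)
      shift-pos (suc m) m<n = shift-pos-suc m (ih (<-trans (n<1+n m) m<n)) (ih m<n)

  backward : 0 < p → ∀ m → Even m → level (suc (suc m)) ≡ P → q (suc (suc m)) ≡ 1 →
             level m ≡ P × q (suc m) ≡ 1
  backward 0<p m ev top q≡1 =
    backward-arith (s≤s 0<p) (level-≤ m) (q-pos m)
      (trans (cong (level (suc m) +_) (sym (shift-even m ev))) (level-even m ev))
      (begin
        L₁ + 1 ⊓ (P ∸ L₁)               ≡⟨ cong (λ x → L₁ + x ⊓ (P ∸ L₁)) q≡1 ⟨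
        L₁ + q (suc (suc m)) ⊓ (P ∸ L₁) ≡⟨ cong (L₁ +_) (shift-odd (suc m) (cong not ev)) ⟨
        L₁ + shift (suc m)              ≡⟨ level-odd (suc m) (cong not ev) ⟨
        level (suc (suc m))             ≡⟨ top ⟩
        P                               ∎)
    where
    open ≡-Reasoning
    L₁ = level (suc m)

  ones-backward : 0 < p → ∀ k a → Even a → OnesAt q a (suc k) →
                  level (a + (suc k + suc k)) ≡ P → q (suc a) ≡ 1
  ones-backward 0<p zero a ev ones top =
    proj₂ (backward 0<p a ev (trans (cong level (+-comm 2 a)) top)
                             (trans (cong q (+-comm 2 a)) (ones 1 ≤-refl ≤-refl)))
  ones-backward 0<p (suc k) a ev ones top =
    ones-backward 0<p k a ev (λ i 1≤i i≤1+k → ones i 1≤i (m≤n⇒m≤1+n i≤1+k))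
      (proj₁ (backward 0<p m (trans (even-+-double a (suc k)) ev)
                             (trans (cong level 2+m≡) top)
                             (trans (cong q 2+m≡) (ones (suc (suc k)) (s≤s z≤n) ≤-refl))))
    where
    m = a + (suc k + suc k)
    2+m≡ = +-double-suc a (suc k)

  module Periodic (r : ℕ) (r-even : Even r) (period : ∀ i → 1 ≤ i → q (r + i) ≡ q i) where

    even-r+ : ∀ i → even (r + i) ≡ even i
    even-r+ i = even-+ˡ r i r-even

    q-periodic : ∀ n → q (suc (r + n)) ≡ q (suc n)
    q-periodic n = trans (cong q (sym (+-suc r n))) (period (suc n) (s≤s z≤n))

    queue-periodic : queue r ≡ queue 0
    queue-periodic =
      at-ext (queue r) (queue 0) (trans (queue-length r) (sym (queue-length 0))) entries
      where
      open ≡-Reasoning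
      entries : ∀ k → k < length (queue r) → at (queue r) (suc k) ≡ at (queue 0) (suc k)
      entries k k<n = begin
        at (queue r) (suc k)  ≡⟨ queue-at r (s≤s z≤n) k<J ⟩
        q (r + suc k)         ≡⟨ period (suc k) (s≤s z≤n) ⟩
        q (suc k)             ≡⟨ queue-at 0 (s≤s z≤n) k<J ⟨
        at (queue 0) (suc k)  ∎
        where k<J = subst (k <_) (queue-length r) k<n

    excess-periodic : ∀ i → excess (r + i) ≡ excess i
    shift-periodic  : ∀ i → shift (r + i) ≡ shift i

    excess-periodic zero    = trans (cong excess (+-identityʳ r)) (+-cancelˡ-≡ (sum (queue 0)) _ _
      (trans (cong (λ qs → sum qs + excess r) (sym queue-periodic)) (sum-queue+excess r)))
    excess-periodic (suc i) = begin
      excess (r + suc i)              ≡⟨ cong excess (+-suc r i) ⟩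
      excess (suc (r + i))            ≡⟨ excess-suc (r + i) ⟩
      q (suc (r + i)) ∸ shift (r + i) ≡⟨ cong₂ _∸_ (q-periodic i) (shift-periodic i) ⟩
      q (suc i) ∸ shift i             ≡⟨ excess-suc i ⟨
      excess (suc i)                  ∎
      where open ≡-Reasoning

    shift-periodic i = +-cancelˡ-≡ (excess i) _ _ (begin
      excess i + shift (r + i)       ≡⟨ cong (_+ shift (r + i)) (excess-periodic i) ⟨
      excess (r + i) + shift (r + i) ≡⟨ q-appended (r + i) ⟨
      q (suc (r + i + J))            ≡⟨ cong (q ∘ suc) (+-assoc r i J) ⟩
      q (suc (r + (i + J)))          ≡⟨ q-periodic (i + J) ⟩
      q (suc (i + J))                ≡⟨ q-appended i ⟩
      excess i + shift i             ∎)
      where open ≡-Reasoning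

    deficit : ℕ
    deficit = P ∸ level r

    level-periodic-drop : ∀ i → level (r + i) + deficit ≡ level i
    level-periodic-drop zero =
      trans (cong (λ n → level n + deficit) (+-identityʳ r)) (m+[n∸m]≡n (level-≤ r))
    level-periodic-drop (suc i) with even-or-odd i
    ... | inj₁ ev = +-cancelʳ-≡ (shift i) _ _ (begin
      level (r + suc i) + deficit + shift i         ≡⟨ cong (λ n → level n + deficit + shift i) (+-suc r i) ⟩
      level (suc (r + i)) + deficit + shift i       ≡⟨ xy∙z≈xz∙y (level (suc (r + i))) deficit (shift i) ⟩
      level (suc (r + i)) + shift i + deficit       ≡⟨ cong (λ s → level (suc (r + i)) + s + deficit)
                                                            (shift-periodic i) ⟨
      level (suc (r + i)) + shift (r + i) + deficit ≡⟨ cong (_+ deficit) (level-even (r + i) (trans (even-r+ i) ev)) ⟩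
      level (r + i) + deficit                       ≡⟨ level-periodic-drop i ⟩
      level i                                       ≡⟨ level-even i ev ⟨
      level (suc i) + shift i                       ∎)
      where open ≡-Reasoning
    ... | inj₂ odd = begin
      level (r + suc i) + deficit             ≡⟨ cong (λ n → level n + deficit) (+-suc r i) ⟩
      level (suc (r + i)) + deficit           ≡⟨ cong (_+ deficit) (level-odd (r + i) (trans (even-r+ i) odd)) ⟩
      level (r + i) + shift (r + i) + deficit ≡⟨ cong (λ s → level (r + i) + s + deficit) (shift-periodic i) ⟩
      level (r + i) + shift i + deficit       ≡⟨ xy∙z≈xz∙y (level (r + i)) (shift i) deficit ⟩
      level (r + i) + deficit + shift i       ≡⟨ cong (_+ shift i) (level-periodic-drop i) ⟩
      level i + shift i                       ≡⟨ level-odd i odd ⟨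
      level (suc i)                           ∎
      where open ≡-Reasoning

    level-multiple : ∀ k → level (k * r) + k * deficit ≡ P
    level-multiple zero    = +-identityʳ P
    level-multiple (suc k) = begin
      level (r + k * r) + (deficit + k * deficit) ≡⟨ +-assoc (level (r + k * r)) deficit (k * deficit) ⟨
      level (r + k * r) + deficit + k * deficit   ≡⟨ cong (_+ k * deficit) (level-periodic-drop (k * r)) ⟩
      level (k * r) + k * deficit                 ≡⟨ level-multiple k ⟩
      P                                           ∎
      where open ≡-Reasoning

    level-period : level r ≡ P
    level-period = ≤-antisym (level-≤ r) (m∸n≡0⇒m≤n (multiples-bounded⇒≡0 multiple≤P))
      where
      multiple≤P : ∀ k → k * deficit ≤ P
      multiple≤P k = subst (k * deficit ≤_) (level-multiple k) (m≤n+m _ _)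

    ones-up-to-r : 0 < p → ∀ a k → a + (suc k + suc k) ≡ r → OnesAt q a (suc k) →
                   q (suc a) ≡ 1
    ones-up-to-r 0<p a k a+2K≡r ones =
      ones-backward 0<p k a a-even ones (trans (cong level a+2K≡r) level-period)
      where
      a-even : Even a
      a-even = trans (sym (even-+-double a (suc k))) (trans (cong even a+2K≡r) r-even)

InMp+⇒2≤v₁ : ∀ {p J Q} → 0 < p → InMp+ p J Q → 2 ≤ at Q 1
InMp+⇒2≤v₁ 0<p (_ , suc zero , _ , _ , _ , _ , 1+p≤ρ₁) = ≤-trans (s≤s 0<p) (ℤ.drop‿+≤+ 1+p≤ρ₁)
InMp+⇒2≤v₁ {Q = Q} _ (Q∈M , suc (suc t) , _ , _ , 2+t≤J , ρ-pos , _) with at Q 1 ≤? at Q 2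
... | yes v₁≤v₂ = contradiction ρ₂≤0 (ℤ.<⇒≱ (ρ-pos 2 (s≤s z≤n) (s≤s (s≤s z≤n))))
  where
  ρ₂≡-[v₂∸v₁] : ρ Q 2 ≡ ℤ.- ℤ.+ (at Q 2 ∸ at Q 1)
  ρ₂≡-[v₂∸v₁] = trans (ℤ.m-n≡m⊖n (at Q 1) (at Q 2)) (ℤ.⊖-≤ v₁≤v₂)
  ρ₂≤0 : ρ Q 2 ℤ.≤ ℤ.+0
  ρ₂≤0 = subst (ℤ._≤ ℤ.+0) (sym ρ₂≡-[v₂∸v₁]) ℤ.neg-≤-pos
... | no  v₁≰v₂ = ≤-trans (s≤s 1≤v₂) (≰⇒> v₁≰v₂)
  where
  1≤v₂ : 1 ≤ at Q 2
  1≤v₂ = InM.pos Q∈M 2 (s≤s z≤n) (≤-trans (s≤s (s≤s z≤n)) 2+t≤J)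

proposition66p2 : (p J : ℕ) (Q : List ℕ) → 0 < p → InMp+ p J Q → D J Q ≢ [] →
    (r : ℕ) → EvenVectorPeriod (C∞ p J Q) r →
    ∃[ j ] (0 < j × RIndex (C∞ p J Q) j r)
proposition66p2 p J Q 0<p Q∈Mp+@(Q∈M , _) _ r (r-even , 0<r , period) =
  RIndexWalk.reaches q r q₁≢1 q[1+r]≢1 (ones-up-to-r 0<p) r0 0<r
  where
  open Dynamics p J Q Q∈M
  open Periodic r r-even period

  q₁≢1 : q 1 ≢ 1
  q₁≢1 q₁≡1 =
    <⇒≱ (InMp+⇒2≤v₁ 0<p Q∈Mp+) (≤-reflexive (trans (sym (q-initial 0 0<J)) q₁≡1))

  q[1+r]≢1 : q (suc r) ≢ 1
  q[1+r]≢1 = q₁≢1 ∘ trans (sym (q-periodic 0)) ∘ trans (cong (q ∘ suc) (+-identityʳ r))
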